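{- Let $d\ge0$ be an integer, $z_0=(x_0,y_0)\in\mathbb{Z}^2$, and let ${\cal A}_d(z_0)$ be an optimal tristance anticode of diameter $d$ in the grid graph ${\cal G}_2$ centered about $z_0$. If $d$ is even, then ${\cal A}_d(z_0)={\mathscr S}_{d/2}(z_0)$. If $d$ is odd, then ${\cal A}_d(z_0)={\mathscr S}_{d/2}(z_0+\xi)$ for some $\xi\in\{(\tfrac12,0),(0,\tfrac12),(-\tfrac12,0),(0,-\tfrac12)\}$.
   Context: The grid graph ${\cal G}_2$ has vertex set $\mathbb{Z}^2$, with $z,z'$ adjacent iff their $L_1$-distance is $1$. For $z_1,z_2,z_3\in\mathbb{Z}^2$, the tristance $d_3(z_1,z_2,z_3)$ is the minimum number of edges of a tree in ${\cal G}_2$ (possibly using additional vertices) containing $z_1,z_2,z_3$. A set ${\cal A}\subset\mathbb{Z}^2$ is a tristance anticode of diameter $d$ centered about $z_0$ if $d_3(z_0,z_1,z_2)\le d$ for all $z_1,z_2\in{\cal A}$; it is optimal if it has the largest possible cardinality among such sets. For $w=(w_1,w_2)\in\mathbb{R}^2$ and real $\rho$, ${\mathscr S}_\rho(w)=\{(x,y)\in\mathbb{Z}^2: |x-w_1|+|y-w_2|\le\rho\}$. -}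

module Defs where

open import Data.Nat using (ℕ; zero; suc; _≤_)
open import Data.Integer using (ℤ; +_; -[1+_]; _-_; _+_; _*_; ∣_∣)
open import Data.Product using (_×_; _,_; ∃-syntax)
open import Data.List using (List; []; _∷_; [_]; length)
open import Data.List.Membership.Propositional using (_∈_; _∉_)
open import Data.List.Relation.Unary.Unique.Propositional using (Unique)
open import Relation.Binary.PropositionalEquality using (_≡_)

Point : Set
Point = ℤ × ℤ

dist : Point → Point → ℕ
dist (x , y) (x' , y') = ∣ x - x' ∣ Data.Nat.+ ∣ y - y' ∣

Adj : Point → Point → Set
Adj z z' = dist z z' ≡ 1

-- Trees in G₂, given by their vertex list and number of edges:
-- a single vertex (0 edges), or a tree extended by a new vertex w
-- joined by a grid edge to an existing vertex u.
data Tree : List Point → ℕ → Set where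
  single : (v : Point) → Tree [ v ] 0
  grow   : ∀ {V n u w} → Tree V n → u ∈ V → Adj u w → w ∉ V → Tree (w ∷ V) (suc n)

-- d₃(z₀,z₁,z₂) ≤ d  : some tree in G₂ with at most d edges contains z₀,z₁,z₂
-- (the minimum is ≤ d iff some such tree has ≤ d edges).
TristanceAtMost : Point → Point → Point → ℕ → Set
TristanceAtMost z₀ z₁ z₂ d =
  ∃[ V ] ∃[ n ] (Tree V n × n ≤ d × z₀ ∈ V × z₁ ∈ V × z₂ ∈ V)

-- a finite set of points, given as a duplicate-free list
-- tristance anticode of diameter d centered about z₀
IsAnticode : ℕ → Point → List Point → Set
IsAnticode d z₀ A =
  Unique A × (∀ {z₁ z₂} → z₁ ∈ A → z₂ ∈ A → TristanceAtMost z₀ z₁ z₂ d)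

-- optimal: an anticode of largest cardinality
-- (every anticode is finite, since d₃(z₀,z,z) = L1-distance ≤ d)
IsOptimalAnticode : ℕ → Point → List Point → Set
IsOptimalAnticode d z₀ A =
  IsAnticode d z₀ A × (∀ B → IsAnticode d z₀ B → length B ≤ length A)

-- doubling, to express half-integer centres and radius d/2 in ℤ
dbl : Point → Point
dbl (x , y) = (+ 2 * x , + 2 * y)

_⊕_ : Point → Point → Point
(a , b) ⊕ (c , e) = (a + c , b + e)

-- InScaledBall c d z  ⇔  z ∈ 𝒮_{d/2}(c/2),
-- i.e. |x - c₁/2| + |y - c₂/2| ≤ d/2, multiplied through by 2.
InScaledBall : Point → ℕ → Point → Set
InScaledBall c d z = dist (dbl z) c ≤ d

-- the four shifts ξ ∈ {(½,0),(0,½),(-½,0),(0,-½)}, doubled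
doubledShifts : List Point
doubledShifts = (+ 1 , + 0) ∷ (+ 0 , + 1) ∷ (-[1+ 0 ] , + 0) ∷ (+ 0 , -[1+ 0 ]) ∷ []

{-# OPTIONS --safe #-}

-- A tree containing z₀, z₁, z₂ has at least |x₁ − x₀| + |y₂ − y₀| edges, since every edge moves
-- only one coordinate by one. Taking z₁ = z₂ shows that an anticode of diameter d has L1-diameter
-- at most d, so in the coordinates σ = x + y, δ = y − x it lies in a square of side d. Counting the
-- lattice points of such squares by parity of the corner, none has more points than the ball about
-- z₀ (d even), resp. about z₀ + (0, ½) (d odd), which is itself an anticode; so an optimal anticode
-- is a full square of the largest kind, i.e. a ball 𝒮_{d/2}(c). Applying the first bound to the
-- extreme points of this ball forces c = z₀ for even d and c = z₀ + ξ with ξ a half-step for odd d.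

module Submission where

open import Defs
open import Data.Nat using (ℕ; suc; _*_)
open import Data.Product using (_×_; ∃-syntax)
open import Data.List using (List)
open import Data.List.Membership.Propositional using (_∈_)
open import Function.Bundles using (_⇔_)
open import Relation.Binary.PropositionalEquality using (_≡_)

open import Algebra.Bundles using (AbelianGroup)
open import Data.Empty using (⊥-elim)
open import Data.Integer using (ℤ; +_; -[1+_]; _+_; _-_; -_; ∣_∣)
import Data.Integer as ℤ
import Data.Integer.Properties as ℤP
open import Data.Integer.Tactic.RingSolver using () renaming (solve-∀ to ℤ-solve)
open import Data.List using ([]; _∷_; [_]; _++_; length; map; upTo; cartesianProductWith)
import Data.List.Properties as List
open import Data.List.Extrema ℤP.≤-totalOrder using (argmin; argmin-sel; f[argmin]≤f[⊤]; f[argmin]≤f[xs])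
open import Data.List.Membership.Propositional.Properties
  using (∈-cartesianProductWith⁺; ∈-cartesianProductWith⁻; ∈-upTo⁺; ∈-upTo⁻; ∈-++⁺ˡ; ∈-++⁺ʳ; ∈-++⁻)
open import Data.List.Relation.Binary.Subset.Propositional using (_⊆_)
import Data.List.Relation.Unary.All as All
open import Data.List.Relation.Unary.AllPairs using (_∷_)
open import Data.List.Relation.Unary.Any using (here; there; any?)
open import Data.List.Relation.Unary.Unique.Propositional using (Unique)
import Data.List.Relation.Unary.Unique.Propositional.Properties as Unique
open import Data.Nat using (zero; z≤n; s≤s) renaming (_+_ to _+ᴺ_; _≤_ to _≤ᴺ_; _<_ to _<ᴺ_)
import Data.Nat.Properties as ℕP
open import Data.Nat.Tactic.RingSolver using () renaming (solve-∀ to ℕ-solve)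
open import Data.Product using (Σ; _,_; proj₁; proj₂; map₂)
open import Data.Product.Properties using (≡-dec)
open import Data.Sum using (_⊎_; inj₁; inj₂)
open import Function.Bundles using (mk⇔; Equivalence)
import Function.Properties.Equivalence as ⇔
open import Relation.Binary.Definitions using (DecidableEquality)
open import Relation.Binary.PropositionalEquality
  using (_≢_; refl; sym; trans; cong; cong₂; subst; subst₂; module ≡-Reasoning)
open import Relation.Nullary using (Dec; yes; no; ¬_)

open import Algebra.Properties.Group (AbelianGroup.group ℤP.+-0-abelianGroup) using () renaming (∙-cancelˡ to +-cancelˡ)

X Y : Point → ℤ
X = proj₁
Y = proj₂

_≟ᴾ_ : (p q : Point) → Dec (p ≡ q)
_≟ᴾ_ = ≡-dec ℤ._≟_ ℤ._≟_

open import Data.List.Membership.DecPropositional _≟ᴾ_ using (_∈?_)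

∣i-i∣≡0 : ∀ i → ∣ i - i ∣ ≡ 0
∣i-i∣≡0 i = cong ∣_∣ (ℤP.+-inverseʳ i)

∣i-k∣≤∣i-j∣+∣j-k∣ : ∀ i j k → ∣ i - k ∣ ≤ᴺ ∣ i - j ∣ +ᴺ ∣ j - k ∣
∣i-k∣≤∣i-j∣+∣j-k∣ i j k = subst (λ t → ∣ t ∣ ≤ᴺ ∣ i - j ∣ +ᴺ ∣ j - k ∣) (telescope i j k) (ℤP.∣i+j∣≤∣i∣+∣j∣ (i - j) (j - k))
  where
  telescope : ∀ i j k → (i - j) + (j - k) ≡ i - k
  telescope = ℤ-solve

dist≡0⇒≡ : ∀ z z' → dist z z' ≡ 0 → z ≡ z'
dist≡0⇒≡ (x , y) (x' , y') h =
  cong₂ _,_ (ℤP.i-j≡0⇒i≡j x x' (ℤP.∣i∣≡0⇒i≡0 (ℕP.m+n≡0⇒m≡0 _ h)))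
            (ℤP.i-j≡0⇒i≡j y y' (ℤP.∣i∣≡0⇒i≡0 (ℕP.m+n≡0⇒n≡0 _ h)))

span-grow : (f : Point → ℤ) {V : List Point} {u w a b : Point} → u ∈ V → a ∈ w ∷ V → b ∈ w ∷ V →
  Σ Point λ a' → Σ Point λ b' → a' ∈ V × b' ∈ V × ∣ f a - f b ∣ ≤ᴺ ∣ f u - f w ∣ +ᴺ ∣ f a' - f b' ∣
span-grow f {u = u} {w} u∈V (here refl) (here refl) =
  u , u , u∈V , u∈V , subst (_≤ᴺ ∣ f u - f w ∣ +ᴺ ∣ f u - f u ∣) (sym (∣i-i∣≡0 (f w))) z≤n
span-grow f {u = u} {w} {b = b} u∈V (here refl) (there b∈V) =
  u , b , u∈V , b∈V ,
  subst (λ t → ∣ f w - f b ∣ ≤ᴺ t +ᴺ ∣ f u - f b ∣) (ℤP.∣i-j∣≡∣j-i∣ (f w) (f u)) (∣i-k∣≤∣i-j∣+∣j-k∣ (f w) (f u) (f b))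
span-grow f {u = u} {w} {a = a} u∈V (there a∈V) (here refl) =
  a , u , a∈V , u∈V ,
  subst (∣ f a - f w ∣ ≤ᴺ_) (ℕP.+-comm (∣ f a - f u ∣) _) (∣i-k∣≤∣i-j∣+∣j-k∣ (f a) (f u) (f w))
span-grow f {a = a} {b = b} u∈V (there a∈V) (there b∈V) = a , b , a∈V , b∈V , ℕP.m≤n+m _ _

-- Every edge changes exactly one coordinate, and by one.
tree-span : ∀ {V n} → Tree V n → ∀ {a b c e} → a ∈ V → b ∈ V → c ∈ V → e ∈ V →
            ∣ X a - X b ∣ +ᴺ ∣ Y c - Y e ∣ ≤ᴺ n
tree-span (single v) (here refl) (here refl) (here refl) (here refl)
  rewrite ∣i-i∣≡0 (X v) | ∣i-i∣≡0 (Y v) = z≤n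
tree-span (grow {n = n} {u} {w} t u∈V edge _) a∈ b∈ c∈ e∈
  with span-grow X u∈V a∈ b∈ | span-grow Y u∈V c∈ e∈
... | a' , b' , a'∈ , b'∈ , spanX | c' , e' , c'∈ , e'∈ , spanY = begin
  _ ≤⟨ ℕP.+-mono-≤ spanX spanY ⟩
  (∣ X u - X w ∣ +ᴺ sx) +ᴺ (∣ Y u - Y w ∣ +ᴺ sy)   ≡⟨ interchange (∣ X u - X w ∣) sx (∣ Y u - Y w ∣) sy ⟩
  dist u w +ᴺ (sx +ᴺ sy)                         ≡⟨ cong (_+ᴺ (sx +ᴺ sy)) edge ⟩
  suc (sx +ᴺ sy)                                 ≤⟨ s≤s (tree-span t a'∈ b'∈ c'∈ e'∈) ⟩
  suc n                                          ∎
  where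
  open ℕP.≤-Reasoning
  sx = ∣ X a' - X b' ∣
  sy = ∣ Y c' - Y e' ∣
  interchange : ∀ p q r s → (p +ᴺ q) +ᴺ (r +ᴺ s) ≡ (p +ᴺ r) +ᴺ (q +ᴺ s)
  interchange = ℕ-solve

∣-∣-step : ∀ (a c : ℤ) m → ∣ a - c ∣ ≡ suc m → Σ ℤ λ a' → ∣ a - a' ∣ ≡ 1 × ∣ a' - c ∣ ≡ m
∣-∣-step a c m h with a - c in eq
... | + _ = a - + 1 , cong ∣_∣ (back a (+ 1)) ,
            cong ∣_∣ (trans (shift a c (+ 1)) (cong (_- + 1) (trans eq (cong +_ h))))
  where
  back : ∀ a o → a - (a - o) ≡ o
  back = ℤ-solve
  shift : ∀ a c o → (a - o) - c ≡ (a - c) - o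
  shift = ℤ-solve
... | -[1+ n ] = a + + 1 , cong ∣_∣ (forth a (+ 1)) ,
                 trans (cong ∣_∣ (trans (shift a c (+ 1)) (cong (_+ + 1) eq))) (∣-[1+n]+1∣ n m h)
  where
  forth : ∀ a o → a - (a + o) ≡ - o
  forth = ℤ-solve
  shift : ∀ a c o → (a + o) - c ≡ (a - c) + o
  shift = ℤ-solve
  ∣-[1+n]+1∣ : ∀ n m → suc n ≡ suc m → ∣ -[1+ n ] + + 1 ∣ ≡ m
  ∣-[1+n]+1∣ zero .zero refl = refl
  ∣-[1+n]+1∣ (suc n) .(suc n) refl = refl

dist-step : ∀ u z n → dist u z ≡ suc n → Σ Point λ w → Adj u w × dist w z ≡ n
dist-step (ux , uy) (zx , zy) n h with ∣ ux - zx ∣ in ex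
... | zero with ∣-∣-step uy zy n h
...   | y' , h₁ , h₂ = (ux , y') , trans (cong (_+ᴺ ∣ uy - y' ∣) (∣i-i∣≡0 ux)) h₁ ,
                       trans (cong (_+ᴺ ∣ y' - zy ∣) ex) h₂
dist-step (ux , uy) (zx , zy) n h | suc m with ∣-∣-step ux zx m ex
...   | x' , h₁ , h₂ = (x' , uy) , trans (cong (∣ ux - x' ∣ +ᴺ_) (∣i-i∣≡0 uy)) (trans (ℕP.+-identityʳ _) h₁) ,
                       trans (cong (_+ᴺ ∣ uy - zy ∣) h₂) (ℕP.suc-injective h)

record TreeReaching (V : List Point) (m n : ℕ) (z : Point) : Set where
  field
    vertices : List Point
    edges    : ℕ
    tree     : Tree vertices edges
    edges≤   : edges ≤ᴺ m +ᴺ n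
    reaches  : z ∈ vertices
    extends  : V ⊆ vertices

tree-reaching : ∀ n {V m u} z → Tree V m → u ∈ V → dist u z ≡ n → TreeReaching V m n z
tree-reaching zero {V} {m} {u} z t u∈V h =
  record { tree = t ; edges≤ = ℕP.m≤m+n m 0 ; reaches = subst (_∈ V) (dist≡0⇒≡ u z h) u∈V ; extends = λ p → p }
tree-reaching (suc n) {V} {m} {u} z t u∈V h with dist-step u z n h
... | w , edge , dist-w with w ∈? V
...   | yes w∈V = record { TreeReaching r ; edges≤ = ℕP.≤-trans edges≤ (ℕP.+-monoʳ-≤ m (ℕP.n≤1+n n)) }
  where
  r = tree-reaching n z t w∈V dist-w
  open TreeReaching r
...   | no w∉V = record { TreeReaching r ; edges≤ = subst (edges ≤ᴺ_) (sym (ℕP.+-suc m n)) edges≤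
                        ; extends = λ p → extends (there p) }
  where
  r = tree-reaching n z (grow t u∈V edge w∉V) (here refl) dist-w
  open TreeReaching r

tristance-via-tree : ∀ {V m} k → Tree V m → ∀ {z₀ r₁ r₂} z₁ z₂ → z₀ ∈ V → r₁ ∈ V → r₂ ∈ V →
  dist r₁ z₁ ≤ᴺ k → dist r₂ z₂ ≤ᴺ k → TristanceAtMost z₀ z₁ z₂ (m +ᴺ (k +ᴺ k))
tristance-via-tree {m = m} k t {z₀} {r₁} {r₂} z₁ z₂ z₀∈ r₁∈ r₂∈ d₁ d₂ =
  vertices T₂ , edges T₂ , tree T₂ , bound , extends T₂ (extends T₁ z₀∈) , extends T₂ (reaches T₁) , reaches T₂
  where
  open TreeReaching
  T₁ = tree-reaching (dist r₁ z₁) z₁ t r₁∈ refl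
  T₂ = tree-reaching (dist r₂ z₂) z₂ (tree T₁) (extends T₁ r₂∈) refl
  open ℕP.≤-Reasoning
  bound : edges T₂ ≤ᴺ m +ᴺ (k +ᴺ k)
  bound = begin
    edges T₂                       ≤⟨ edges≤ T₂ ⟩
    edges T₁ +ᴺ dist r₂ z₂         ≤⟨ ℕP.+-mono-≤ (edges≤ T₁) d₂ ⟩
    (m +ᴺ dist r₁ z₁) +ᴺ k         ≤⟨ ℕP.+-monoˡ-≤ k (ℕP.+-monoʳ-≤ m d₁) ⟩
    (m +ᴺ k) +ᴺ k                  ≡⟨ ℕP.+-assoc m k k ⟩
    m +ᴺ (k +ᴺ k)                  ∎

anticode-dist≤ : ∀ {d z₀ A} → IsAnticode d z₀ A → ∀ {z₁ z₂} → z₁ ∈ A → z₂ ∈ A → dist z₁ z₂ ≤ᴺ d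
anticode-dist≤ (_ , anti) p₁ p₂ with anti p₁ p₂
... | _ , _ , t , n≤d , _ , q₁ , q₂ = ℕP.≤-trans (tree-span t q₁ q₂ q₁ q₂) n≤d

anticode-cross≤ : ∀ {d z₀ A} → IsAnticode d z₀ A → ∀ {z₁ z₂} → z₁ ∈ A → z₂ ∈ A →
                  ∣ X z₁ - X z₀ ∣ +ᴺ ∣ Y z₂ - Y z₀ ∣ ≤ᴺ d
anticode-cross≤ (_ , anti) p₁ p₂ with anti p₁ p₂
... | _ , _ , t , n≤d , q₀ , q₁ , q₂ = ℕP.≤-trans (tree-span t q₁ q₀ q₂ q₀) n≤d

-- Rotated coordinates

σ δ : Point → ℤ
σ z = X z + Y z
δ z = Y z - X z

i+i≡j+j⇒i≡j : ∀ i j → i + i ≡ j + j → i ≡ j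
i+i≡j+j⇒i≡j i j h = ℤP.*-cancelˡ-≡ (+ 2) i j (trans (double i) (trans h (sym (double j))))
  where
  double : ∀ i → + 2 ℤ.* i ≡ i + i
  double = ℤ-solve

σδ-injective : ∀ z w → σ z ≡ σ w → δ z ≡ δ w → z ≡ w
σδ-injective (zx , zy) (wx , wy) hσ hδ =
  cong₂ _,_ (i+i≡j+j⇒i≡j zx wx (trans (sym (x+x zx zy)) (trans (cong₂ _-_ hσ hδ) (x+x wx wy))))
            (i+i≡j+j⇒i≡j zy wy (trans (sym (y+y zx zy)) (trans (cong₂ _+_ hσ hδ) (y+y wx wy))))
  where
  x+x : ∀ x y → (x + y) - (y - x) ≡ x + x
  x+x = ℤ-solve
  y+y : ∀ x y → (x + y) + (y - x) ≡ y + y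
  y+y = ℤ-solve

InRotatedSquare : ℤ → ℤ → ℕ → Point → Set
InRotatedSquare u₀ v₀ d z = (Σ ℕ λ i → i ≤ᴺ d × σ z ≡ u₀ + + i) × (Σ ℕ λ l → l ≤ᴺ d × δ z ≡ v₀ + + l)

i≤+∣i∣ : ∀ i → i ℤ.≤ + ∣ i ∣
i≤+∣i∣ (+ n) = ℤP.≤-refl
i≤+∣i∣ -[1+ n ] = ℤ.-≤+

σ-σ≤dist : ∀ z w → σ z - σ w ℤ.≤ + dist z w
σ-σ≤dist z w = subst (ℤ._≤ + dist z w) (sym (regroup (X z) (Y z) (X w) (Y w)))
  (ℤP.+-mono-≤ (i≤+∣i∣ (X z - X w)) (i≤+∣i∣ (Y z - Y w)))
  where
  regroup : ∀ a b c e → (a + b) - (c + e) ≡ (a - c) + (b - e)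
  regroup = ℤ-solve

δ-δ≤dist : ∀ z w → δ z - δ w ℤ.≤ + dist z w
δ-δ≤dist z w = subst₂ ℤ._≤_ (sym (regroup (X z) (Y z) (X w) (Y w))) (cong +_ (ℕP.+-comm ∣ Y z - Y w ∣ ∣ X z - X w ∣))
  (ℤP.+-mono-≤ (i≤+∣i∣ (Y z - Y w)) (subst (λ t → - (X z - X w) ℤ.≤ + t) (ℤP.∣-i∣≡∣i∣ (X z - X w)) (i≤+∣i∣ (- (X z - X w)))))
  where
  regroup : ∀ a b c e → (b - a) - (e - c) ≡ (b - e) + - (a - c)
  regroup = ℤ-solve

≤-offset : ∀ a b d → a ℤ.≤ b → b - a ℤ.≤ + d → Σ ℕ λ i → i ≤ᴺ d × b ≡ a + + i
≤-offset a b d a≤b b-a≤d = ∣ a - b ∣ , ℤP.drop‿+≤+ (subst (ℤ._≤ + d) (sym ∣a-b∣≡b-a) b-a≤d) ,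
    trans (sym (cancel a b)) (cong (λ t → a + t) (sym ∣a-b∣≡b-a))
  where
  ∣a-b∣≡b-a : + ∣ a - b ∣ ≡ b - a
  ∣a-b∣≡b-a = ℤP.∣-∣-≤ a≤b
  cancel : ∀ a b → a + (b - a) ≡ b
  cancel = ℤ-solve

anticode⊆rotatedSquare : ∀ {d z₀ A} → IsAnticode d z₀ A → ∀ {z₂ z₃} → z₂ ∈ A → z₃ ∈ A →
  (∀ {w} → w ∈ A → σ z₂ ℤ.≤ σ w) → (∀ {w} → w ∈ A → δ z₃ ℤ.≤ δ w) →
  ∀ {z} → z ∈ A → InRotatedSquare (σ z₂) (δ z₃) d z
anticode⊆rotatedSquare {d} an {z₂} {z₃} z₂∈ z₃∈ σ-min δ-min {z} z∈ =
  ≤-offset (σ z₂) (σ z) d (σ-min z∈) (ℤP.≤-trans (σ-σ≤dist z z₂) (ℤ.+≤+ (anticode-dist≤ an z∈ z₂∈))) ,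
  ≤-offset (δ z₃) (δ z) d (δ-min z∈) (ℤP.≤-trans (δ-δ≤dist z z₃) (ℤ.+≤+ (anticode-dist≤ an z∈ z₃∈)))

∣i∣+∣j∣≡∣i+j∣⊎∣j-i∣ : ∀ i j → (∣ i ∣ +ᴺ ∣ j ∣ ≡ ∣ i + j ∣) ⊎ (∣ i ∣ +ᴺ ∣ j ∣ ≡ ∣ j - i ∣)
∣i∣+∣j∣≡∣i+j∣⊎∣j-i∣ (+ m) (+ n) = inj₁ refl
∣i∣+∣j∣≡∣i+j∣⊎∣j-i∣ -[1+ m ] -[1+ n ] = inj₁ (cong suc (ℕP.+-suc m n))
∣i∣+∣j∣≡∣i+j∣⊎∣j-i∣ (+ zero) -[1+ n ] = inj₂ refl
∣i∣+∣j∣≡∣i+j∣⊎∣j-i∣ (+ suc m) -[1+ n ] = inj₂ (cong suc (trans (ℕP.+-suc m n) (cong suc (ℕP.+-comm m n))))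
∣i∣+∣j∣≡∣i+j∣⊎∣j-i∣ -[1+ m ] (+ n) = inj₂ (ℕP.+-comm (suc m) n)

∣i∣+∣j∣≤n⇔ : ∀ i j n → (∣ i ∣ +ᴺ ∣ j ∣ ≤ᴺ n) ⇔ (∣ i + j ∣ ≤ᴺ n × ∣ j - i ∣ ≤ᴺ n)
∣i∣+∣j∣≤n⇔ i j n = mk⇔ to from
  where
  to : ∣ i ∣ +ᴺ ∣ j ∣ ≤ᴺ n → ∣ i + j ∣ ≤ᴺ n × ∣ j - i ∣ ≤ᴺ n
  to h = ℕP.≤-trans (ℤP.∣i+j∣≤∣i∣+∣j∣ i j) h ,
         ℕP.≤-trans (ℤP.∣i-j∣≤∣i∣+∣j∣ j i) (subst (_≤ᴺ n) (ℕP.+-comm ∣ i ∣ ∣ j ∣) h)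
  from : ∣ i + j ∣ ≤ᴺ n × ∣ j - i ∣ ≤ᴺ n → ∣ i ∣ +ᴺ ∣ j ∣ ≤ᴺ n
  from (h₁ , h₂) with ∣i∣+∣j∣≡∣i+j∣⊎∣j-i∣ i j
  ... | inj₁ e = subst (_≤ᴺ n) (sym e) h₁
  ... | inj₂ e = subst (_≤ᴺ n) (sym e) h₂

∣i+i-n∣≤n⇔ : ∀ i n → (∣ i + i - + n ∣ ≤ᴺ n) ⇔ (Σ ℕ λ k → k ≤ᴺ n × i ≡ + k)
∣i+i-n∣≤n⇔ i n = mk⇔ (to i) from
  where
  from : (Σ ℕ λ k → k ≤ᴺ n × i ≡ + k) → ∣ i + i - + n ∣ ≤ᴺ n
  from (k , k≤n , refl) with ℕP.m≤n⇒∃[o]m+o≡n k≤n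
  ... | s , refl = subst (λ t → ∣ t ∣ ≤ᴺ k +ᴺ s) (sym (trans (cong (λ t → + k + + k - t) (ℤP.pos-+ k s)) (cancel (+ k) (+ s))))
                     (ℤP.∣i-j∣≤∣i∣+∣j∣ (+ k) (+ s))
    where
    cancel : ∀ k s → k + k - (k + s) ≡ k - s
    cancel = ℤ-solve
  to : ∀ i → ∣ i + i - + n ∣ ≤ᴺ n → Σ ℕ λ k → k ≤ᴺ n × i ≡ + k
  to (+ m) h with m ℕP.≤? n
  ... | yes m≤n = m , m≤n , refl
  ... | no m≰n with ℕP.m≤n⇒∃[o]m+o≡n (ℕP.≰⇒> m≰n)
  ...   | s , refl = ⊥-elim (ℕP.<-irrefl refl (ℕP.≤-trans (ℕP.m≤m+n (suc n) s)
                       (ℕP.≤-trans (ℕP.m≤m+n (suc n +ᴺ s) (suc s)) (subst (_≤ᴺ n) (cong ∣_∣ excess) h))))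
    where
    shift : ∀ m n s → m + (n + s) - n ≡ m + s
    shift = ℤ-solve
    excess : + (suc n +ᴺ s) + + (suc n +ᴺ s) - + n ≡ + (suc n +ᴺ s +ᴺ suc s)
    excess = trans (cong (λ t → + (suc n +ᴺ s) + t - + n) (trans (cong +_ (sym (ℕP.+-suc n s))) (ℤP.pos-+ n (suc s))))
                   (shift (+ (suc n +ᴺ s)) (+ n) (+ suc s))
  to -[1+ m ] h = ⊥-elim (ℕP.<-irrefl refl (ℕP.≤-trans
      (subst (_≤ᴺ n +ᴺ (suc m +ᴺ suc m)) (ℕP.+-comm n 1) (ℕP.+-monoʳ-≤ n (s≤s z≤n)))
      (subst (_≤ᴺ n) (trans (cong ∣_∣ deficit) (ℤP.∣-i∣≡∣i∣ (+ (n +ᴺ (suc m +ᴺ suc m))))) h)))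
    where
    negate : ∀ m n → (- m) + (- m) - n ≡ - (n + (m + m))
    negate = ℤ-solve
    deficit : -[1+ m ] + -[1+ m ] - + n ≡ - (+ (n +ᴺ (suc m +ᴺ suc m)))
    deficit = trans (negate (+ suc m) (+ n)) (cong -_ (sym (ℤP.pos-+ n (suc m +ᴺ suc m))))

i-j≡k⇔i≡j+k : ∀ i j k → (i - j ≡ k) ⇔ (i ≡ j + k)
i-j≡k⇔i≡j+k i j k = mk⇔ (λ { refl → sym (cancel j i) }) (λ { refl → cancel′ j k })
  where
  cancel : ∀ j i → j + (i - j) ≡ i
  cancel = ℤ-solve
  cancel′ : ∀ j k → (j + k) - j ≡ k
  cancel′ = ℤ-solve

offset⇔ : ∀ a b n → (∣ (b - a) + (b - a) - + n ∣ ≤ᴺ n) ⇔ (Σ ℕ λ k → k ≤ᴺ n × b ≡ a + + k)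
offset⇔ a b n = ⇔.trans (∣i+i-n∣≤n⇔ (b - a) n)
  (mk⇔ (map₂ λ {k} → map₂ (Equivalence.to (i-j≡k⇔i≡j+k b a (+ k))))
       (map₂ λ {k} → map₂ (Equivalence.from (i-j≡k⇔i≡j+k b a (+ k)))))

inScaledBall⇔inRotatedSquare : ∀ C u₀ v₀ d z → σ C ≡ u₀ + u₀ + + d → δ C ≡ v₀ + v₀ + + d →
                            InScaledBall C d z ⇔ InRotatedSquare u₀ v₀ d z
inScaledBall⇔inRotatedSquare C u₀ v₀ d z hσ hδ =
  ⇔.trans (∣i∣+∣j∣≤n⇔ P Q d) (mk⇔
    (λ (h₁ , h₂) → to (offset⇔ u₀ (σ z) d) (bound P+Q≡ h₁) , to (offset⇔ v₀ (δ z) d) (bound Q-P≡ h₂))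
    (λ (b₁ , b₂) → bound (sym P+Q≡) (from (offset⇔ u₀ (σ z) d) b₁) , bound (sym Q-P≡) (from (offset⇔ v₀ (δ z) d) b₂)))
  where
  open Equivalence
  P = + 2 ℤ.* X z - X C
  Q = + 2 ℤ.* Y z - Y C
  open ≡-Reasoning
  P+Q≡ : P + Q ≡ (σ z - u₀) + (σ z - u₀) - + d
  P+Q≡ = begin
    P + Q                               ≡⟨ regroup (X z) (Y z) (X C) (Y C) ⟩
    (σ z + σ z) - σ C                   ≡⟨ cong (λ t → (σ z + σ z) - t) hσ ⟩
    (σ z + σ z) - (u₀ + u₀ + + d)       ≡⟨ shift (σ z) u₀ (+ d) ⟩
    (σ z - u₀) + (σ z - u₀) - + d       ∎
    where
    regroup : ∀ x y cx cy → (+ 2 ℤ.* x - cx) + (+ 2 ℤ.* y - cy) ≡ ((x + y) + (x + y)) - (cx + cy)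
    regroup = ℤ-solve
    shift : ∀ s u e → (s + s) - (u + u + e) ≡ (s - u) + (s - u) - e
    shift = ℤ-solve
  Q-P≡ : Q - P ≡ (δ z - v₀) + (δ z - v₀) - + d
  Q-P≡ = begin
    Q - P                               ≡⟨ regroup (X z) (Y z) (X C) (Y C) ⟩
    (δ z + δ z) - δ C                   ≡⟨ cong (λ t → (δ z + δ z) - t) hδ ⟩
    (δ z + δ z) - (v₀ + v₀ + + d)       ≡⟨ shift (δ z) v₀ (+ d) ⟩
    (δ z - v₀) + (δ z - v₀) - + d       ∎
    where
    regroup : ∀ x y cx cy → (+ 2 ℤ.* y - cy) - (+ 2 ℤ.* x - cx) ≡ ((y - x) + (y - x)) - (cy - cx)
    regroup = ℤ-solve
    shift : ∀ s u e → (s + s) - (u + u + e) ≡ (s - u) + (s - u) - e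
    shift = ℤ-solve
  bound : ∀ {i j} → i ≡ j → ∣ i ∣ ≤ᴺ d → ∣ j ∣ ≤ᴺ d
  bound refl h = h

-- Enumerating the lattice points of a rotated square

σ-⊕ : ∀ p o → σ (p ⊕ o) ≡ σ p + σ o
σ-⊕ (x , y) (a , b) = regroup x y a b
  where
  regroup : ∀ x y a b → (x + a) + (y + b) ≡ (x + y) + (a + b)
  regroup = ℤ-solve

δ-⊕ : ∀ p o → δ (p ⊕ o) ≡ δ p + δ o
δ-⊕ (x , y) (a , b) = regroup x y a b
  where
  regroup : ∀ x y a b → (y + b) - (x + a) ≡ (y - x) + (b - a)
  regroup = ℤ-solve

cell : Point → ℕ → ℕ → Point
cell p a j = p ⊕ (+ a - + j , + a + + j)

σ-cell : ∀ p a j → σ (cell p a j) ≡ σ p + + (a +ᴺ a)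
σ-cell p a j = trans (σ-⊕ p _) (cong (λ t → σ p + t) (trans (cancel (+ a) (+ j)) (sym (ℤP.pos-+ a a))))
  where
  cancel : ∀ a j → (a - j) + (a + j) ≡ a + a
  cancel = ℤ-solve

δ-cell : ∀ p a j → δ (cell p a j) ≡ δ p + + (j +ᴺ j)
δ-cell p a j = trans (δ-⊕ p _) (cong (λ t → δ p + t) (trans (cancel (+ a) (+ j)) (sym (ℤP.pos-+ j j))))
  where
  cancel : ∀ a j → (a + j) - (a - j) ≡ j + j
  cancel = ℤ-solve

≡cell : ∀ z p a j → σ z ≡ σ p + + (a +ᴺ a) → δ z ≡ δ p + + (j +ᴺ j) → z ≡ cell p a j
≡cell z p a j hσ hδ = σδ-injective z (cell p a j) (trans hσ (sym (σ-cell p a j))) (trans hδ (sym (δ-cell p a j)))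

2*n≡n+n : ∀ n → 2 * n ≡ n +ᴺ n
2*n≡n+n = ℕ-solve

a+a≡b+b⇒a≡b : ∀ a b → a +ᴺ a ≡ b +ᴺ b → a ≡ b
a+a≡b+b⇒a≡b a b h = ℕP.*-cancelˡ-≡ a b 2 (trans (2*n≡n+n a) (trans h (sym (2*n≡n+n b))))

cell-injective : ∀ p {a j a' j'} → cell p a j ≡ cell p a' j' → a ≡ a' × j ≡ j'
cell-injective p {a} {j} {a'} {j'} h =
  a+a≡b+b⇒a≡b a a' (ℤP.+-injective (+-cancelˡ (σ p) _ _ (trans (sym (σ-cell p a j)) (trans (cong σ h) (σ-cell p a' j'))))) ,
  a+a≡b+b⇒a≡b j j' (ℤP.+-injective (+-cancelˡ (δ p) _ _ (trans (sym (δ-cell p a j)) (trans (cong δ h) (δ-cell p a' j')))))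

grid : Point → ℕ → ℕ → List Point
grid p m n = cartesianProductWith (cell p) (upTo m) (upTo n)

∈-grid⁺ : ∀ p {m n a j} → a <ᴺ m → j <ᴺ n → cell p a j ∈ grid p m n
∈-grid⁺ p a<m j<n = ∈-cartesianProductWith⁺ (cell p) (∈-upTo⁺ a<m) (∈-upTo⁺ j<n)

∈-grid⁻ : ∀ p m n {z} → z ∈ grid p m n → Σ ℕ λ a → Σ ℕ λ j → a <ᴺ m × j <ᴺ n × z ≡ cell p a j
∈-grid⁻ p m n z∈ with ∈-cartesianProductWith⁻ (cell p) (upTo m) (upTo n) z∈
... | a , j , a∈ , j∈ , z≡ = a , j , ∈-upTo⁻ a∈ , ∈-upTo⁻ j∈ , z≡

grid-unique : ∀ p m n → Unique (grid p m n)
grid-unique p m n = Unique.cartesianProductWith⁺ (cell p) (cell-injective p) (Unique.upTo⁺ m) (Unique.upTo⁺ n)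

length-cartesianProductWith : ∀ {A B C : Set} (f : A → B → C) xs ys →
                              length (cartesianProductWith f xs ys) ≡ length xs * length ys
length-cartesianProductWith f [] ys = refl
length-cartesianProductWith f (x ∷ xs) ys = trans (List.length-++ (map (f x) ys))
  (cong₂ _+ᴺ_ (List.length-map (f x) ys) (length-cartesianProductWith f xs ys))

length-grid : ∀ p m n → length (grid p m n) ≡ m * n
length-grid p m n = trans (length-cartesianProductWith (cell p) (upTo m) (upTo n))
                          (cong₂ _*_ (List.length-upTo m) (List.length-upTo n))

-- The lattice points of the rotated square of side h + h′ (h′ ∈ {h, 1 + h}) with corner (σ q, δ q),
-- resp. (σ q, δ q - 1); the two grids collect the points with σ - σ q even, resp. odd.
evenSquare oddSquare : Point → ℕ → ℕ → List Point
evenSquare q h h' = grid q (suc h) (suc h) ++ grid (q ⊕ (+ 0 , + 1)) h' h'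
oddSquare q h h' = grid q (suc h) h' ++ grid (q ⊕ (+ 1 , + 0)) h' (suc h)

length-evenSquare : ∀ q h h' → length (evenSquare q h h') ≡ suc h * suc h +ᴺ h' * h'
length-evenSquare q h h' = trans (List.length-++ (grid q (suc h) (suc h)))
  (cong₂ _+ᴺ_ (length-grid q (suc h) (suc h)) (length-grid (q ⊕ (+ 0 , + 1)) h' h'))

length-oddSquare : ∀ q h h' → length (oddSquare q h h') ≡ suc h * h' +ᴺ h' * suc h
length-oddSquare q h h' = trans (List.length-++ (grid q (suc h) h'))
  (cong₂ _+ᴺ_ (length-grid q (suc h) h') (length-grid (q ⊕ (+ 1 , + 0)) h' (suc h)))

a+a≢1+b+b : ∀ a b → a +ᴺ a ≢ suc (b +ᴺ b)
a+a≢1+b+b a b h = ℕP.even≢odd a b (trans (2*n≡n+n a) (trans h (cong suc (sym (2*n≡n+n b)))))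

i+i≢j+j+1 : ∀ i j → i + i ≢ j + j + + 1
i+i≢j+j+1 i j h = twice≢1 (i - j) (trans (regroup i j) (trans (cong (_- (j + j)) h) (cancel j (+ 1))))
  where
  regroup : ∀ i j → (i - j) + (i - j) ≡ (i + i) - (j + j)
  regroup = ℤ-solve
  cancel : ∀ j o → (j + j + o) - (j + j) ≡ o
  cancel = ℤ-solve
  twice≢1 : ∀ t → t + t ≢ + 1
  twice≢1 (+ n) e = a+a≢1+b+b n 0 (ℤP.+-injective e)
  twice≢1 -[1+ n ] ()

evenSquare-unique : ∀ q h h' → Unique (evenSquare q h h')
evenSquare-unique q h h' = Unique.++⁺ (grid-unique q (suc h) (suc h)) (grid-unique q' h' h') disjoint
  where
  q' = q ⊕ (+ 0 , + 1)
  disjoint : ∀ {z} → ¬ (z ∈ grid q (suc h) (suc h) × z ∈ grid q' h' h')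
  disjoint (z∈ , z∈') with ∈-grid⁻ q (suc h) (suc h) z∈ | ∈-grid⁻ q' h' h' z∈'
  ... | a , j , _ , _ , refl | a' , j' , _ , _ , eq =
    a+a≢1+b+b a a' (ℤP.+-injective (+-cancelˡ (σ q) _ _ (begin
      σ q + + (a +ᴺ a)          ≡⟨ sym (σ-cell q a j) ⟩
      σ (cell q a j)            ≡⟨ cong σ eq ⟩
      σ (cell q' a' j')         ≡⟨ σ-cell q' a' j' ⟩
      σ q' + + (a' +ᴺ a')       ≡⟨ cong (_+ + (a' +ᴺ a')) (σ-⊕ q _) ⟩
      (σ q + + 1) + + (a' +ᴺ a') ≡⟨ ℤP.+-assoc (σ q) (+ 1) _ ⟩
      σ q + + suc (a' +ᴺ a')    ∎)))
    where open ≡-Reasoning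

halve : ∀ n → Σ ℕ λ a → (n ≡ a +ᴺ a) ⊎ (n ≡ suc (a +ᴺ a))
halve zero = 0 , inj₁ refl
halve (suc n) with halve n
... | a , inj₁ e = a , inj₂ (cong suc e)
... | a , inj₂ e = suc a , inj₁ (cong suc (trans e (sym (ℕP.+-suc a a))))

a+a≤h+h'⇒a<1+h : ∀ a {h h'} → a +ᴺ a ≤ᴺ h +ᴺ h' → h' ≤ᴺ suc h → a <ᴺ suc h
a+a≤h+h'⇒a<1+h a {h} {h'} a+a≤ h'≤ with a ℕP.≤? h
... | yes a≤h = s≤s a≤h
... | no a≰h = ⊥-elim (ℕP.<-irrefl refl (ℕP.≤-trans (ℕP.+-mono-≤ h<a h<a) (ℕP.≤-trans a+a≤ (ℕP.+-monoʳ-≤ h h'≤))))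
  where
  h<a : suc h ≤ᴺ a
  h<a = ℕP.≰⇒> a≰h

1+a+a≤h+h'⇒a<h' : ∀ a {h h'} → suc (a +ᴺ a) ≤ᴺ h +ᴺ h' → h ≤ᴺ h' → a <ᴺ h'
1+a+a≤h+h'⇒a<h' a {h} {h'} a+a< h≤ with suc a ℕP.≤? h'
... | yes a<h' = a<h'
... | no a≮h' = ⊥-elim (ℕP.<-irrefl refl (ℕP.≤-trans (s≤s (ℕP.+-mono-≤ h'≤a h'≤a)) (ℕP.≤-trans a+a< (ℕP.+-monoˡ-≤ h' h≤))))
  where
  h'≤a : h' ≤ᴺ a
  h'≤a = ℕP.≤-pred (ℕP.≰⇒> a≮h')

Y+Y≡σ+δ : ∀ z → Y z + Y z ≡ σ z + δ z
Y+Y≡σ+δ (x , y) = regroup x y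
  where
  regroup : ∀ x y → y + y ≡ (x + y) + (y - x)
  regroup = ℤ-solve

+1-shift : ∀ c a → c + (+ 1 + a) ≡ (c + + 1) + a
+1-shift c a = sym (ℤP.+-assoc c (+ 1) a)

-- Points of a square have σ + δ = 2y even, which forces the parities of the two offsets.
inRotatedSquare⇒∈evenSquare : ∀ h h' q {z} → h' ≤ᴺ suc h → h ≤ᴺ h' →
  InRotatedSquare (σ q) (δ q) (h +ᴺ h') z → z ∈ evenSquare q h h'
inRotatedSquare⇒∈evenSquare h h' q {z} h'≤ h≤ ((i , i≤ , σz) , (l , l≤ , δz)) with halve i | halve l
... | a , inj₁ refl | j , inj₁ refl =
  ∈-++⁺ˡ (subst (_∈ grid q (suc h) (suc h)) (sym (≡cell z q a j σz δz))
    (∈-grid⁺ q (a+a≤h+h'⇒a<1+h a i≤ h'≤) (a+a≤h+h'⇒a<1+h j l≤ h'≤)))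
... | a , inj₂ refl | j , inj₂ refl =
  ∈-++⁺ʳ (grid q (suc h) (suc h)) (subst (_∈ grid q' h' h') (sym (≡cell z q' a j σz' δz'))
    (∈-grid⁺ q' (1+a+a≤h+h'⇒a<h' a i≤ h≤) (1+a+a≤h+h'⇒a<h' j l≤ h≤)))
  where
  q' = q ⊕ (+ 0 , + 1)
  σz' = trans σz (trans (+1-shift (σ q) _) (cong (_+ + (a +ᴺ a)) (sym (σ-⊕ q _))))
  δz' = trans δz (trans (+1-shift (δ q) _) (cong (_+ + (j +ᴺ j)) (sym (δ-⊕ q _))))
... | a , inj₁ refl | j , inj₂ refl =
  ⊥-elim (i+i≢j+j+1 (Y z) (Y q + + a + + j) (trans (Y+Y≡σ+δ z) (trans (cong₂ _+_ σz δz) (regroup (X q) (Y q) (+ a) (+ j)))))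
  where
  regroup : ∀ x y a j → ((x + y) + (a + a)) + ((y - x) + (+ 1 + (j + j))) ≡ (y + a + j) + (y + a + j) + + 1
  regroup = ℤ-solve
... | a , inj₂ refl | j , inj₁ refl =
  ⊥-elim (i+i≢j+j+1 (Y z) (Y q + + a + + j) (trans (Y+Y≡σ+δ z) (trans (cong₂ _+_ σz δz) (regroup (X q) (Y q) (+ a) (+ j)))))
  where
  regroup : ∀ x y a j → ((x + y) + (+ 1 + (a + a))) + ((y - x) + (j + j)) ≡ (y + a + j) + (y + a + j) + + 1
  regroup = ℤ-solve

inRotatedSquare⇒∈oddSquare : ∀ h h' q {z} → h' ≤ᴺ suc h → h ≤ᴺ h' →
  InRotatedSquare (σ q) (δ q - + 1) (h +ᴺ h') z → z ∈ oddSquare q h h'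
inRotatedSquare⇒∈oddSquare h h' q {z} h'≤ h≤ ((i , i≤ , σz) , (l , l≤ , δz)) with halve i | halve l
... | a , inj₁ refl | j , inj₂ refl =
  ∈-++⁺ˡ (subst (_∈ grid q (suc h) h') (sym (≡cell z q a j σz δz'))
    (∈-grid⁺ q (a+a≤h+h'⇒a<1+h a i≤ h'≤) (1+a+a≤h+h'⇒a<h' j l≤ h≤)))
  where
  cancel : ∀ c a → (c - + 1) + (+ 1 + a) ≡ c + a
  cancel = ℤ-solve
  δz' = trans δz (cancel (δ q) _)
... | a , inj₂ refl | j , inj₁ refl =
  ∈-++⁺ʳ (grid q (suc h) h') (subst (_∈ grid q' h' (suc h)) (sym (≡cell z q' a j σz' δz'))
    (∈-grid⁺ q' (1+a+a≤h+h'⇒a<h' a i≤ h≤) (a+a≤h+h'⇒a<1+h j l≤ h'≤)))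
  where
  q' = q ⊕ (+ 1 , + 0)
  σz' = trans σz (trans (+1-shift (σ q) _) (cong (_+ + (a +ᴺ a)) (sym (σ-⊕ q _))))
  δz' = trans δz (cong (_+ + (j +ᴺ j)) (sym (δ-⊕ q _)))
... | a , inj₁ refl | j , inj₁ refl =
  ⊥-elim (i+i≢j+j+1 (Y z) (Y q + + a + + j - + 1)
    (trans (Y+Y≡σ+δ z) (trans (cong₂ _+_ σz δz) (regroup (X q) (Y q) (+ a) (+ j)))))
  where
  regroup : ∀ x y a j → ((x + y) + (a + a)) + (((y - x) - + 1) + (j + j)) ≡ (y + a + j - + 1) + (y + a + j - + 1) + + 1
  regroup = ℤ-solve
... | a , inj₂ refl | j , inj₂ refl =
  ⊥-elim (i+i≢j+j+1 (Y z) (Y q + + a + + j) (trans (Y+Y≡σ+δ z) (trans (cong₂ _+_ σz δz) (regroup (X q) (Y q) (+ a) (+ j)))))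
  where
  regroup : ∀ x y a j → ((x + y) + (+ 1 + (a + a))) + (((y - x) - + 1) + (+ 1 + (j + j))) ≡ (y + a + j) + (y + a + j) + + 1
  regroup = ℤ-solve

module _ {A : Set} where

  ∈-remove : ∀ {y : A} {E} → y ∈ E → Σ (List A) λ E' → length E ≡ suc (length E') × (∀ {z} → z ∈ E → z ≢ y → z ∈ E')
  ∈-remove {E = y ∷ E} (here refl) = E , refl , λ { (here refl) z≢y → ⊥-elim (z≢y refl) ; (there z∈) _ → z∈ }
  ∈-remove {E = x ∷ E} (there y∈) with ∈-remove y∈
  ... | E' , len , keep = x ∷ E' , cong suc len , λ { (here refl) _ → here refl ; (there z∈) z≢y → there (keep z∈ z≢y) }

  Unique-⊆⇒length≤ : ∀ {L E : List A} → Unique L → L ⊆ E → length L ≤ᴺ length E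
  Unique-⊆⇒length≤ {[]} _ _ = z≤n
  Unique-⊆⇒length≤ {x ∷ L} {E} (x∉L ∷ uL) L⊆E with ∈-remove (L⊆E (here refl))
  ... | E' , len , keep = subst (suc (length L) ≤ᴺ_) (sym len)
    (s≤s (Unique-⊆⇒length≤ uL λ z∈L → keep (L⊆E (there z∈L)) λ { refl → All.lookup x∉L z∈L refl }))

  Unique-⊆-length≥⇒⊇ : DecidableEquality A → ∀ {L E : List A} → Unique L → L ⊆ E → length E ≤ᴺ length L → E ⊆ L
  Unique-⊆-length≥⇒⊇ _≟_ {L} uL L⊆E len {y} y∈E with any? (y ≟_) L
  ... | yes y∈L = y∈L
  ... | no y∉L with ∈-remove y∈E
  ...   | E' , lenE , keep = ⊥-elim (ℕP.<-irrefl refl (ℕP.≤-trans (subst (_≤ᴺ length L) lenE len)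
            (Unique-⊆⇒length≤ uL λ z∈L → keep (L⊆E z∈L) λ { refl → y∉L z∈L })))

-- Balls about z₀ are anticodes

dist-cell≤ : ∀ r s m a j → X s ≡ X r → Y s ≡ Y r - + m → a ≤ᴺ m → j ≤ᴺ m → dist r (cell s a j) ≤ᴺ m
dist-cell≤ r s m a j xs ys a≤m j≤m = Equivalence.from (∣i∣+∣j∣≤n⇔ P Q m)
  (subst (_≤ᴺ m) (sym (trans (cong ∣_∣ P+Q≡) (ℤP.∣-i∣≡∣i∣ ((+ a + + a) - + m))))
     (Equivalence.from (∣i+i-n∣≤n⇔ (+ a) m) (a , a≤m , refl)) ,
   subst (_≤ᴺ m) (sym (trans (cong ∣_∣ Q-P≡) (ℤP.∣-i∣≡∣i∣ ((+ j + + j) - + m))))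
     (Equivalence.from (∣i+i-n∣≤n⇔ (+ j) m) (j , j≤m , refl)))
  where
  P = X r - (X s + (+ a - + j))
  Q = Y r - (Y s + (+ a + + j))
  sum : ∀ x y a j m → (x - (x + (a - j))) + (y - ((y - m) + (a + j))) ≡ - ((a + a) - m)
  sum = ℤ-solve
  difference : ∀ x y a j m → (y - ((y - m) + (a + j))) - (x - (x + (a - j))) ≡ - ((j + j) - m)
  difference = ℤ-solve
  P+Q≡ : P + Q ≡ - ((+ a + + a) - + m)
  P+Q≡ = trans (cong₂ (λ xs ys → (X r - (xs + (+ a - + j))) + (Y r - (ys + (+ a + + j)))) xs ys)
               (sum (X r) (Y r) (+ a) (+ j) (+ m))
  Q-P≡ : Q - P ≡ - ((+ j + + j) - + m)
  Q-P≡ = trans (cong₂ (λ xs ys → (Y r - (ys + (+ a + + j))) - (X r - (xs + (+ a - + j)))) xs ys)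
               (difference (X r) (Y r) (+ a) (+ j) (+ m))

-- For h′ = h it enumerates 𝒮_h(z₀); for h′ = h + 1 it enumerates 𝒮_{h+½}(z₀ + (0, ½)).
ballList : Point → ℕ → ℕ → List Point
ballList z₀ h h' = evenSquare (z₀ ⊕ (+ 0 , - + h)) h h'

ballList-near : ∀ h h' z₀ {z} → z ∈ ballList z₀ h h' →
  dist z₀ z ≤ᴺ h ⊎ Σ ℕ λ a → Σ ℕ λ j → a <ᴺ h' × j <ᴺ h' × z ≡ cell ((z₀ ⊕ (+ 0 , - + h)) ⊕ (+ 0 , + 1)) a j
ballList-near h h' z₀ z∈ with ∈-++⁻ (grid (z₀ ⊕ (+ 0 , - + h)) (suc h) (suc h)) z∈
... | inj₂ z∈' = inj₂ (∈-grid⁻ ((z₀ ⊕ (+ 0 , - + h)) ⊕ (+ 0 , + 1)) h' h' z∈')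
... | inj₁ z∈' with ∈-grid⁻ (z₀ ⊕ (+ 0 , - + h)) (suc h) (suc h) z∈'
...   | a , j , a< , j< , refl = inj₁ (dist-cell≤ z₀ _ h a j (ℤP.+-identityʳ (X z₀)) refl (ℕP.≤-pred a<) (ℕP.≤-pred j<))

ball-near-even : ∀ h z₀ {z} → z ∈ ballList z₀ h h → dist z₀ z ≤ᴺ h
ball-near-even h z₀ z∈ with ballList-near h h z₀ z∈
... | inj₁ near = near
ball-near-even (suc h) z₀ z∈ | inj₂ (a , j , a< , j< , refl) =
  ℕP.m≤n⇒m≤1+n (dist-cell≤ z₀ _ h a j (trans (ℤP.+-identityʳ _) (ℤP.+-identityʳ (X z₀)))
    (trans (cong (λ t → (Y z₀ - t) + + 1) (ℤP.pos-+ 1 h)) (cancel (Y z₀) (+ h) (+ 1))) (ℕP.≤-pred a<) (ℕP.≤-pred j<))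
  where
  cancel : ∀ y h o → (y - (o + h)) + o ≡ y - h
  cancel = ℤ-solve

ball-near-odd : ∀ h z₀ {z} → z ∈ ballList z₀ h (suc h) → dist z₀ z ≤ᴺ h ⊎ dist (z₀ ⊕ (+ 0 , + 1)) z ≤ᴺ h
ball-near-odd h z₀ z∈ with ballList-near h (suc h) z₀ z∈
... | inj₁ near = inj₁ near
... | inj₂ (a , j , a< , j< , refl) =
  inj₂ (dist-cell≤ (z₀ ⊕ (+ 0 , + 1)) _ h a j (ℤP.+-identityʳ _) (swap (Y z₀) (+ h) (+ 1)) (ℕP.≤-pred a<) (ℕP.≤-pred j<))
  where
  swap : ∀ y h o → (y - h) + o ≡ (y + o) - h
  swap = ℤ-solve

ballList-isAnticode-even : ∀ h z₀ → IsAnticode (h +ᴺ h) z₀ (ballList z₀ h h)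
ballList-isAnticode-even h z₀ = evenSquare-unique (z₀ ⊕ (+ 0 , - + h)) h h ,
  λ {z₁} {z₂} z₁∈ z₂∈ → tristance-via-tree h (single z₀) z₁ z₂ (here refl) (here refl) (here refl)
                                            (ball-near-even h z₀ z₁∈) (ball-near-even h z₀ z₂∈)

-- Each point is within h of one end of the edge from z₀ to z₀ + (0, 1).
ballList-isAnticode-odd : ∀ h z₀ → IsAnticode (h +ᴺ suc h) z₀ (ballList z₀ h (suc h))
ballList-isAnticode-odd h z₀ = evenSquare-unique (z₀ ⊕ (+ 0 , - + h)) h (suc h) , tristance
  where
  z₁₀ = z₀ ⊕ (+ 0 , + 1)
  step-up : dist z₀ z₁₀ ≡ 1
  step-up = cong₂ _+ᴺ_ (cong ∣_∣ (opposite (X z₀) (+ 0))) (cong ∣_∣ (opposite (Y z₀) (+ 1)))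
    where
    opposite : ∀ x o → x - (x + o) ≡ - o
    opposite = ℤ-solve
  edge : Tree (z₁₀ ∷ [ z₀ ]) 1
  edge = grow (single z₀) (here refl) step-up
    λ { (here z₁₀≡z₀) → ℕP.1+n≢0 (trans (sym step-up)
          (trans (cong (dist z₀) z₁₀≡z₀) (cong₂ _+ᴺ_ (∣i-i∣≡0 (X z₀)) (∣i-i∣≡0 (Y z₀))))) }
  root : ∀ {z} → dist z₀ z ≤ᴺ h ⊎ dist z₁₀ z ≤ᴺ h → Σ Point λ r → r ∈ z₁₀ ∷ [ z₀ ] × dist r z ≤ᴺ h
  root (inj₁ near) = z₀ , there (here refl) , near
  root (inj₂ near) = z₁₀ , here refl , near
  tristance : ∀ {z₁ z₂} → z₁ ∈ ballList z₀ h (suc h) → z₂ ∈ ballList z₀ h (suc h) → TristanceAtMost z₀ z₁ z₂ (h +ᴺ suc h)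
  tristance {z₁} {z₂} z₁∈ z₂∈ with root (ball-near-odd h z₀ z₁∈) | root (ball-near-odd h z₀ z₂∈)
  ... | r₁ , r₁∈ , d₁ | r₂ , r₂∈ , d₂ = subst (TristanceAtMost z₀ z₁ z₂) (sym (ℕP.+-suc h h))
    (tristance-via-tree h edge z₁ z₂ (there (here refl)) r₁∈ r₂∈ d₁ d₂)

minimiser : (f : Point → ℤ) (x : Point) (L : List Point) →
            Σ Point λ m → m ∈ x ∷ L × (∀ {w} → w ∈ x ∷ L → f m ℤ.≤ f w)
minimiser f x L = argmin f x L , selected (argmin-sel f x L) , minimal
  where
  selected : argmin f x L ≡ x ⊎ argmin f x L ∈ L → argmin f x L ∈ x ∷ L
  selected (inj₁ ≡x) = here ≡x
  selected (inj₂ ∈L) = there ∈L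
  minimal : ∀ {w} → w ∈ x ∷ L → f (argmin f x L) ℤ.≤ f w
  minimal (here refl) = f[argmin]≤f[⊤] {f = f} x L
  minimal (there w∈L) = All.lookup (f[argmin]≤f[xs] {f = f} x L) w∈L

halveℤ : ∀ i → Σ ℤ λ t → (i ≡ t + t) ⊎ (i ≡ t + t + + 1)
halveℤ (+ n) with halve n
... | a , inj₁ refl = + a , inj₁ refl
... | a , inj₂ refl = + a , inj₂ (ℤP.+-comm (+ 1) (+ (a +ᴺ a)))
halveℤ -[1+ n ] with halve (suc n)
... | a , inj₁ e = - + a , inj₁ (trans (cong (λ k → - + k) e) (negate (+ a)))
  where
  negate : ∀ a → - (a + a) ≡ (- a) + (- a)
  negate = ℤ-solve
... | a , inj₂ e = - + a - + 1 , inj₂ (trans (cong (λ k → - + k) e) (negate (+ a)))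
  where
  negate : ∀ a → - (+ 1 + (a + a)) ≡ ((- a - + 1) + (- a - + 1)) + + 1
  negate = ℤ-solve

-- σ q and δ q always have the same parity, so these are the only two kinds of corner.
corner-lattice : ∀ u₀ v₀ → Σ Point λ q → σ q ≡ u₀ × (δ q ≡ v₀ ⊎ δ q - + 1 ≡ v₀)
corner-lattice u₀ v₀ with halveℤ (u₀ - v₀)
... | t , parity = (t , u₀ - t) , cancel t u₀ , corner parity
  where
  cancel : ∀ t u → t + (u - t) ≡ u
  cancel = ℤ-solve
  even : ∀ v t → (v + (t + t) - t) - t ≡ v
  even = ℤ-solve
  odd : ∀ v t → ((v + (t + t + + 1) - t) - t) - + 1 ≡ v
  odd = ℤ-solve
  u₀≡ : ∀ {k} → u₀ - v₀ ≡ k → u₀ ≡ v₀ + k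
  u₀≡ = Equivalence.to (i-j≡k⇔i≡j+k u₀ v₀ _)
  corner : (u₀ - v₀ ≡ t + t) ⊎ (u₀ - v₀ ≡ t + t + + 1) → ((u₀ - t) - t ≡ v₀) ⊎ (((u₀ - t) - t) - + 1 ≡ v₀)
  corner (inj₁ e) = inj₁ (subst (λ u → (u - t) - t ≡ v₀) (sym (u₀≡ e)) (even v₀ t))
  corner (inj₂ e) = inj₂ (subst (λ u → ((u - t) - t) - + 1 ≡ v₀) (sym (u₀≡ e)) (odd v₀ t))

⊆LatticeSquare : ℕ → List Point → Point → Set
⊆LatticeSquare d A q =
  (∀ {z} → z ∈ A → InRotatedSquare (σ q) (δ q) d z) ⊎ (∀ {z} → z ∈ A → InRotatedSquare (σ q) (δ q - + 1) d z)

IsLatticeSquare : ℕ → List Point → Point → Set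
IsLatticeSquare d A q =
  (∀ z → (z ∈ A) ⇔ InRotatedSquare (σ q) (δ q) d z) ⊎ (∀ z → (z ∈ A) ⇔ InRotatedSquare (σ q) (δ q - + 1) d z)

anticode⊆latticeSquare : ∀ {d z₀ x L} → IsAnticode d z₀ (x ∷ L) → Σ Point (⊆LatticeSquare d (x ∷ L))
anticode⊆latticeSquare {d} {x = x} {L} an with minimiser σ x L | minimiser δ x L
... | z₂ , z₂∈ , σ-min | z₃ , z₃∈ , δ-min with corner-lattice (σ z₂) (δ z₃)
...   | q , σq , inj₁ δq = q , inj₁ λ {z} z∈ →
          subst₂ (λ u v → InRotatedSquare u v d z) (sym σq) (sym δq) (anticode⊆rotatedSquare an z₂∈ z₃∈ σ-min δ-min z∈)
...   | q , σq , inj₂ δq = q , inj₂ λ {z} z∈ →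
          subst₂ (λ u v → InRotatedSquare u v d z) (sym σq) (sym δq) (anticode⊆rotatedSquare an z₂∈ z₃∈ σ-min δ-min z∈)

⇔-by-counting : ∀ {P : Point → Set} {A E : List Point} → Unique A → (∀ {z} → z ∈ A → P z) → (∀ {z} → P z → z ∈ E) →
                length E ≤ᴺ length A → ∀ z → (z ∈ A) ⇔ P z
⇔-by-counting uA A⇒P P⇒E len z = mk⇔ A⇒P (λ p → Unique-⊆-length≥⇒⊇ _≟ᴾ_ uA (λ z∈A → P⇒E (A⇒P z∈A)) len (P⇒E p))

length-evenSquare-≡ : ∀ q q' h h' → length (evenSquare q h h') ≡ length (evenSquare q' h h')
length-evenSquare-≡ q q' h h' = trans (length-evenSquare q h h') (sym (length-evenSquare q' h h'))

length-evenSquare≡1+oddSquare : ∀ q q' h → length (evenSquare q' h h) ≡ suc (length (oddSquare q h h))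
length-evenSquare≡1+oddSquare q q' h =
  trans (length-evenSquare q' h h) (trans (count h) (cong suc (sym (length-oddSquare q h h))))
  where
  count : ∀ h → suc h * suc h +ᴺ h * h ≡ suc (suc h * h +ᴺ h * suc h)
  count = ℕ-solve

length-oddSquare≡evenSquare : ∀ q q' h → length (oddSquare q h (suc h)) ≡ length (evenSquare q' h (suc h))
length-oddSquare≡evenSquare q q' h =
  trans (length-oddSquare q h (suc h))
    (trans (cong (suc h * suc h +ᴺ_) (ℕP.*-comm (suc h) (suc h))) (sym (length-evenSquare q' h (suc h))))

optimal-even⇒square : ∀ h z₀ A → IsOptimalAnticode (h +ᴺ h) z₀ A →
  Σ Point λ q → ∀ z → (z ∈ A) ⇔ InRotatedSquare (σ q) (δ q) (h +ᴺ h) z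
optimal-even⇒square h z₀ [] (_ , opt) =
  ⊥-elim (ℕP.n≮0 (subst (_≤ᴺ 0) (length-evenSquare (z₀ ⊕ (+ 0 , - + h)) h h)
    (opt (ballList z₀ h h) (ballList-isAnticode-even h z₀))))
optimal-even⇒square h z₀ A@(_ ∷ _) (an , opt) = shape (anticode⊆latticeSquare an)
  where
  ball≤A : length (ballList z₀ h h) ≤ᴺ length A
  ball≤A = opt (ballList z₀ h h) (ballList-isAnticode-even h z₀)
  shape : Σ Point (⊆LatticeSquare (h +ᴺ h) A) → Σ Point λ q → ∀ z → (z ∈ A) ⇔ InRotatedSquare (σ q) (δ q) (h +ᴺ h) z
  shape (q , inj₁ A⊆) = q , ⇔-by-counting (proj₁ an) A⊆ (inRotatedSquare⇒∈evenSquare h h q (ℕP.n≤1+n h) ℕP.≤-refl)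
                              (subst (_≤ᴺ length A) (length-evenSquare-≡ (z₀ ⊕ (+ 0 , - + h)) q h h) ball≤A)
  shape (q , inj₂ A⊆) = ⊥-elim (ℕP.<-irrefl refl (ℕP.≤-trans
    (subst (_≤ᴺ length A) (length-evenSquare≡1+oddSquare q (z₀ ⊕ (+ 0 , - + h)) h) ball≤A)
    (Unique-⊆⇒length≤ (proj₁ an) λ z∈ → inRotatedSquare⇒∈oddSquare h h q (ℕP.n≤1+n h) ℕP.≤-refl (A⊆ z∈))))

optimal-odd⇒square : ∀ h z₀ A → IsOptimalAnticode (h +ᴺ suc h) z₀ A → Σ Point (IsLatticeSquare (h +ᴺ suc h) A)
optimal-odd⇒square h z₀ [] (_ , opt) =
  ⊥-elim (ℕP.n≮0 (subst (_≤ᴺ 0) (length-evenSquare (z₀ ⊕ (+ 0 , - + h)) h (suc h))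
    (opt (ballList z₀ h (suc h)) (ballList-isAnticode-odd h z₀))))
optimal-odd⇒square h z₀ A@(_ ∷ _) (an , opt) = shape (anticode⊆latticeSquare an)
  where
  ball≤A : length (ballList z₀ h (suc h)) ≤ᴺ length A
  ball≤A = opt (ballList z₀ h (suc h)) (ballList-isAnticode-odd h z₀)
  shape : Σ Point (⊆LatticeSquare (h +ᴺ suc h) A) → Σ Point (IsLatticeSquare (h +ᴺ suc h) A)
  shape (q , inj₁ A⊆) = q , inj₁ (⇔-by-counting (proj₁ an) A⊆ (inRotatedSquare⇒∈evenSquare h (suc h) q ℕP.≤-refl (ℕP.n≤1+n h))
                                   (subst (_≤ᴺ length A) (length-evenSquare-≡ (z₀ ⊕ (+ 0 , - + h)) q h (suc h)) ball≤A))
  shape (q , inj₂ A⊆) = q , inj₂ (⇔-by-counting (proj₁ an) A⊆ (inRotatedSquare⇒∈oddSquare h (suc h) q ℕP.≤-refl (ℕP.n≤1+n h))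
                                   (subst (_≤ᴺ length A) (sym (length-oddSquare≡evenSquare q (z₀ ⊕ (+ 0 , - + h)) h)) ball≤A))
-- Locating the centre

-- The doubled centres of the squares with corner (σ q, δ q), resp. (σ q, δ q - 1).
centre centre′ : Point → ℕ → Point
centre q d = (+ 2 ℤ.* X q , + 2 ℤ.* Y q + + d)
centre′ q d = (+ 2 ℤ.* X q + + 1 , + 2 ℤ.* Y q + + d - + 1)

inRotatedSquare⇔inScaledBall[centre] : ∀ q d z → InRotatedSquare (σ q) (δ q) d z ⇔ InScaledBall (centre q d) d z
inRotatedSquare⇔inScaledBall[centre] q d z = ⇔.sym (inScaledBall⇔inRotatedSquare (centre q d) (σ q) (δ q) d z
  (regroup (X q) (Y q) (+ d)) (regroup′ (X q) (Y q) (+ d)))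
  where
  regroup : ∀ x y d → + 2 ℤ.* x + (+ 2 ℤ.* y + d) ≡ (x + y) + (x + y) + d
  regroup = ℤ-solve
  regroup′ : ∀ x y d → (+ 2 ℤ.* y + d) - + 2 ℤ.* x ≡ (y - x) + (y - x) + d
  regroup′ = ℤ-solve

inRotatedSquare⇔inScaledBall[centre′] : ∀ q d z → InRotatedSquare (σ q) (δ q - + 1) d z ⇔ InScaledBall (centre′ q d) d z
inRotatedSquare⇔inScaledBall[centre′] q d z = ⇔.sym (inScaledBall⇔inRotatedSquare (centre′ q d) (σ q) (δ q - + 1) d z
  (regroup (X q) (Y q) (+ d)) (regroup′ (X q) (Y q) (+ d)))
  where
  regroup : ∀ x y d → (+ 2 ℤ.* x + + 1) + (+ 2 ℤ.* y + d - + 1) ≡ (x + y) + (x + y) + d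
  regroup = ℤ-solve
  regroup′ : ∀ x y d → (+ 2 ℤ.* y + d - + 1) - (+ 2 ℤ.* x + + 1) ≡ ((y - x) - + 1) + ((y - x) - + 1) + d
  regroup′ = ℤ-solve

⊕-inSquare : ∀ q o {d} i l → σ o ≡ + i → δ o ≡ + l → i ≤ᴺ d → l ≤ᴺ d → InRotatedSquare (σ q) (δ q) d (q ⊕ o)
⊕-inSquare q o i l σo δo i≤ l≤ =
  (i , i≤ , trans (σ-⊕ q o) (cong (λ t → σ q + t) σo)) , (l , l≤ , trans (δ-⊕ q o) (cong (λ t → δ q + t) δo))

⊕-inSquare′ : ∀ q o {d} i l → σ o ≡ + i → δ o + + 1 ≡ + l → i ≤ᴺ d → l ≤ᴺ d → InRotatedSquare (σ q) (δ q - + 1) d (q ⊕ o)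
⊕-inSquare′ q o i l σo δo i≤ l≤ =
  (i , i≤ , trans (σ-⊕ q o) (cong (λ t → σ q + t) σo)) ,
  (l , l≤ , trans (δ-⊕ q o) (trans (regroup (δ q) (δ o)) (cong (λ t → (δ q - + 1) + t) δo)))
  where
  regroup : ∀ c e → c + e ≡ (c - + 1) + (e + + 1)
  regroup = ℤ-solve

x-offset : ∀ q o z₀ → X (q ⊕ o) - X z₀ ≡ (X q - X z₀) + X o
x-offset q o z₀ = regroup (X q) (X z₀) (X o)
  where
  regroup : ∀ a b c → (a + c) - b ≡ (a - b) + c
  regroup = ℤ-solve

y-offset : ∀ q o z₀ k e → Y o ≡ k + e → Y (q ⊕ o) - Y z₀ ≡ ((Y q + k) - Y z₀) + e
y-offset q o z₀ k e Yo = trans (cong (λ t → (Y q + t) - Y z₀) Yo) (regroup (Y q) (Y z₀) k e)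
  where
  regroup : ∀ a b k e → (a + (k + e)) - b ≡ ((a + k) - b) + e
  regroup = ℤ-solve

∣-[1+m]-n∣ : ∀ m n → ∣ -[1+ m ] - + n ∣ ≡ suc m +ᴺ n
∣-[1+m]-n∣ m zero = sym (ℕP.+-identityʳ (suc m))
∣-[1+m]-n∣ m (suc n) = cong suc (sym (ℕP.+-suc m n))

∣i+n∣⊎∣i-n∣ : ∀ i n → (∣ i + + n ∣ ≡ ∣ i ∣ +ᴺ n) ⊎ (∣ i - + n ∣ ≡ ∣ i ∣ +ᴺ n)
∣i+n∣⊎∣i-n∣ (+ m) n = inj₁ refl
∣i+n∣⊎∣i-n∣ -[1+ m ] n = inj₂ (∣-[1+m]-n∣ m n)

∣i+1+n∣⊎∣i-n∣ : ∀ i n → Σ ℕ λ ρ → ((∣ i + + suc n ∣ ≡ ρ +ᴺ suc n) ⊎ (∣ i - + n ∣ ≡ ρ +ᴺ suc n)) ×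
                                 (ρ ≡ 0 → (i ≡ + 0) ⊎ (i ≡ -[1+ 0 ]))
∣i+1+n∣⊎∣i-n∣ (+ m) n = m , inj₁ refl , λ m≡0 → inj₁ (cong +_ m≡0)
∣i+1+n∣⊎∣i-n∣ -[1+ m ] n = m , inj₂ (trans (∣-[1+m]-n∣ m n) (sym (ℕP.+-suc m n))) , λ m≡0 → inj₂ (cong -[1+_] m≡0)

m+h+n+k≤h+k⇒m≡0×n≡0 : ∀ m n h k → (m +ᴺ h) +ᴺ (n +ᴺ k) ≤ᴺ h +ᴺ k → m ≡ 0 × n ≡ 0
m+h+n+k≤h+k⇒m≡0×n≡0 m n h k le = ℕP.n≤0⇒n≡0 (ℕP.m+n≤o⇒m≤o m m+n≤0) , ℕP.n≤0⇒n≡0 (ℕP.m+n≤o⇒n≤o m m+n≤0)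
  where
  regroup : ∀ m n h k → (m +ᴺ h) +ᴺ (n +ᴺ k) ≡ (h +ᴺ k) +ᴺ (m +ᴺ n)
  regroup = ℕ-solve
  m+n≤0 : m +ᴺ n ≤ᴺ 0
  m+n≤0 = ℕP.+-cancelˡ-≤ (h +ᴺ k) (m +ᴺ n) 0
    (subst₂ _≤ᴺ_ (regroup m n h k) (sym (ℕP.+-identityʳ (h +ᴺ k))) le)

centre-even : ∀ h z₀ q {A} → IsAnticode (h +ᴺ h) z₀ A → (∀ {z} → InRotatedSquare (σ q) (δ q) (h +ᴺ h) z → z ∈ A) →
              centre q (h +ᴺ h) ≡ dbl z₀
centre-even h z₀ q {A} an square⊆A = cong₂ _,_ (cong (+ 2 ℤ.*_) Xq≡) (trans (regroup (Y q) (+ h)) (cong (+ 2 ℤ.*_) Yq+h≡))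
  where
  d = h +ᴺ h
  Dx = X q - X z₀
  Dy = (Y q + + h) - Y z₀
  far-x : Σ Point λ z₁ → z₁ ∈ A × ∣ X z₁ - X z₀ ∣ ≡ ∣ Dx ∣ +ᴺ h
  far-x with ∣i+n∣⊎∣i-n∣ Dx h
  ... | inj₁ e = q ⊕ (+ h , + h) , square⊆A (⊕-inSquare q _ d 0 refl (ℤP.+-inverseʳ (+ h)) ℕP.≤-refl z≤n) ,
                 trans (cong ∣_∣ (x-offset q (+ h , + h) z₀)) e
  ... | inj₂ e = q ⊕ (- + h , + h) , square⊆A (⊕-inSquare q _ 0 d (ℤP.+-inverseˡ (+ h))
                   (cong (λ t → + h + t) (ℤP.neg-involutive (+ h))) z≤n ℕP.≤-refl) ,
                 trans (cong ∣_∣ (x-offset q (- + h , + h) z₀)) e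
  far-y : Σ Point λ z₂ → z₂ ∈ A × ∣ Y z₂ - Y z₀ ∣ ≡ ∣ Dy ∣ +ᴺ h
  far-y with ∣i+n∣⊎∣i-n∣ Dy h
  ... | inj₁ e = q ⊕ (+ 0 , + d) , square⊆A (⊕-inSquare q _ d d refl (ℤP.+-identityʳ (+ d)) ℕP.≤-refl ℕP.≤-refl) ,
                 trans (cong ∣_∣ (y-offset q (+ 0 , + d) z₀ (+ h) (+ h) refl)) e
  ... | inj₂ e = q ⊕ (+ 0 , + 0) , square⊆A (⊕-inSquare q _ 0 0 refl refl z≤n z≤n) ,
                 trans (cong ∣_∣ (y-offset q (+ 0 , + 0) z₀ (+ h) (- + h) (sym (ℤP.+-inverseʳ (+ h))))) e
  zeros : ∣ Dx ∣ ≡ 0 × ∣ Dy ∣ ≡ 0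
  zeros with far-x | far-y
  ... | z₁ , z₁∈ , e₁ | z₂ , z₂∈ , e₂ =
    m+h+n+k≤h+k⇒m≡0×n≡0 ∣ Dx ∣ ∣ Dy ∣ h h (subst (_≤ᴺ d) (cong₂ _+ᴺ_ e₁ e₂) (anticode-cross≤ an z₁∈ z₂∈))
  Xq≡ : X q ≡ X z₀
  Xq≡ = ℤP.i-j≡0⇒i≡j (X q) (X z₀) (ℤP.∣i∣≡0⇒i≡0 (proj₁ zeros))
  Yq+h≡ : Y q + + h ≡ Y z₀
  Yq+h≡ = ℤP.i-j≡0⇒i≡j (Y q + + h) (Y z₀) (ℤP.∣i∣≡0⇒i≡0 (proj₂ zeros))
  regroup : ∀ y h → + 2 ℤ.* y + (h + h) ≡ + 2 ℤ.* (y + h)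
  regroup = ℤ-solve

h+h≤h+1+h : ∀ h → h +ᴺ h ≤ᴺ h +ᴺ suc h
h+h≤h+1+h h = ℕP.+-monoʳ-≤ h (ℕP.n≤1+n h)

centre-odd : ∀ h z₀ q {A} → IsAnticode (h +ᴺ suc h) z₀ A → (∀ {z} → InRotatedSquare (σ q) (δ q) (h +ᴺ suc h) z → z ∈ A) →
             ∃[ ξ ] (ξ ∈ doubledShifts × centre q (h +ᴺ suc h) ≡ dbl z₀ ⊕ ξ)
centre-odd h z₀ q {A} an square⊆A with ∣i+1+n∣⊎∣i-n∣ ((Y q + + h) - Y z₀) h
... | ρ , far , ρ≡0⇒ = (+ 0 , W + W + + 1) , shift∈ (ρ≡0⇒ (proj₂ zeros)) ,
                       cong₂ _,_ (trans (cong (+ 2 ℤ.*_) Xq≡) (sym (ℤP.+-identityʳ _))) y-eq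
  where
  d = h +ᴺ suc h
  Dx = X q - X z₀
  W = (Y q + + h) - Y z₀
  far-x : Σ Point λ z₁ → z₁ ∈ A × ∣ X z₁ - X z₀ ∣ ≡ ∣ Dx ∣ +ᴺ h
  far-x with ∣i+n∣⊎∣i-n∣ Dx h
  ... | inj₁ e = q ⊕ (+ h , + h) , square⊆A (⊕-inSquare q _ (h +ᴺ h) 0 refl (ℤP.+-inverseʳ (+ h)) (h+h≤h+1+h h) z≤n) ,
                 trans (cong ∣_∣ (x-offset q (+ h , + h) z₀)) e
  ... | inj₂ e = q ⊕ (- + h , + h) , square⊆A (⊕-inSquare q _ 0 (h +ᴺ h) (ℤP.+-inverseˡ (+ h))
                   (cong (λ t → + h + t) (ℤP.neg-involutive (+ h))) z≤n (h+h≤h+1+h h)) ,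
                 trans (cong ∣_∣ (x-offset q (- + h , + h) z₀)) e
  far-y : (∣ W + + suc h ∣ ≡ ρ +ᴺ suc h) ⊎ (∣ W - + h ∣ ≡ ρ +ᴺ suc h) → Σ Point λ z₂ → z₂ ∈ A × ∣ Y z₂ - Y z₀ ∣ ≡ ρ +ᴺ suc h
  far-y (inj₁ e) = q ⊕ (+ 0 , + d) , square⊆A (⊕-inSquare q _ d d refl (ℤP.+-identityʳ (+ d)) ℕP.≤-refl ℕP.≤-refl) ,
                   trans (cong ∣_∣ (y-offset q (+ 0 , + d) z₀ (+ h) (+ suc h) refl)) e
  far-y (inj₂ e) = q ⊕ (+ 0 , + 0) , square⊆A (⊕-inSquare q _ 0 0 refl refl z≤n z≤n) ,
                   trans (cong ∣_∣ (y-offset q (+ 0 , + 0) z₀ (+ h) (- + h) (sym (ℤP.+-inverseʳ (+ h))))) e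
  zeros : ∣ Dx ∣ ≡ 0 × ρ ≡ 0
  zeros with far-x | far-y far
  ... | z₁ , z₁∈ , e₁ | z₂ , z₂∈ , e₂ =
    m+h+n+k≤h+k⇒m≡0×n≡0 ∣ Dx ∣ ρ h (suc h) (subst (_≤ᴺ d) (cong₂ _+ᴺ_ e₁ e₂) (anticode-cross≤ an z₁∈ z₂∈))
  Xq≡ : X q ≡ X z₀
  Xq≡ = ℤP.i-j≡0⇒i≡j (X q) (X z₀) (ℤP.∣i∣≡0⇒i≡0 (proj₁ zeros))
  regroup : ∀ y h → + 2 ℤ.* y + (h + (+ 1 + h)) ≡ + 2 ℤ.* (y + h) + + 1
  regroup = ℤ-solve
  expand : ∀ y w → + 2 ℤ.* (y + w) + + 1 ≡ + 2 ℤ.* y + (w + w + + 1)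
  expand = ℤ-solve
  y-eq : + 2 ℤ.* Y q + + d ≡ + 2 ℤ.* Y z₀ + (W + W + + 1)
  y-eq = trans (regroup (Y q) (+ h))
    (trans (cong (λ t → + 2 ℤ.* t + + 1) (Equivalence.to (i-j≡k⇔i≡j+k (Y q + + h) (Y z₀) W) refl)) (expand (Y z₀) W))
  shift∈ : (W ≡ + 0) ⊎ (W ≡ -[1+ 0 ]) → (+ 0 , W + W + + 1) ∈ doubledShifts
  shift∈ (inj₁ e) = subst (λ w → (+ 0 , w + w + + 1) ∈ doubledShifts) (sym e) (there (here refl))
  shift∈ (inj₂ e) = subst (λ w → (+ 0 , w + w + + 1) ∈ doubledShifts) (sym e) (there (there (there (here refl))))

centre′-odd : ∀ h z₀ q {A} → IsAnticode (h +ᴺ suc h) z₀ A → (∀ {z} → InRotatedSquare (σ q) (δ q - + 1) (h +ᴺ suc h) z → z ∈ A) →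
              ∃[ ξ ] (ξ ∈ doubledShifts × centre′ q (h +ᴺ suc h) ≡ dbl z₀ ⊕ ξ)
centre′-odd h z₀ q {A} an square⊆A with ∣i+1+n∣⊎∣i-n∣ (X q - X z₀) h
... | ρ , far , ρ≡0⇒ = (W + W + + 1 , + 0) , shift∈ (ρ≡0⇒ (proj₁ zeros)) , cong₂ _,_ x-eq y-eq
  where
  d = h +ᴺ suc h
  W = X q - X z₀
  Dy = (Y q + + h) - Y z₀
  far-x : (∣ W + + suc h ∣ ≡ ρ +ᴺ suc h) ⊎ (∣ W - + h ∣ ≡ ρ +ᴺ suc h) → Σ Point λ z₁ → z₁ ∈ A × ∣ X z₁ - X z₀ ∣ ≡ ρ +ᴺ suc h
  far-x (inj₁ e) = q ⊕ (+ suc h , + h) ,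
                   square⊆A (⊕-inSquare′ q _ d 0 (ℤP.+-comm (+ suc h) (+ h)) (cancel (+ h)) ℕP.≤-refl z≤n) ,
                   trans (cong ∣_∣ (x-offset q (+ suc h , + h) z₀)) e
    where
    cancel : ∀ h → (h - (+ 1 + h)) + + 1 ≡ + 0
    cancel = ℤ-solve
  far-x (inj₂ e) = q ⊕ (- + h , + h) , square⊆A (⊕-inSquare′ q _ 0 d (ℤP.+-inverseˡ (+ h)) (regroup (+ h)) z≤n ℕP.≤-refl) ,
                   trans (cong ∣_∣ (x-offset q (- + h , + h) z₀)) e
    where
    regroup : ∀ h → (h - (- h)) + + 1 ≡ h + (+ 1 + h)
    regroup = ℤ-solve
  far-y : Σ Point λ z₂ → z₂ ∈ A × ∣ Y z₂ - Y z₀ ∣ ≡ ∣ Dy ∣ +ᴺ h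
  far-y with ∣i+n∣⊎∣i-n∣ Dy h
  ... | inj₁ e = q ⊕ (+ 0 , + (h +ᴺ h)) , square⊆A (⊕-inSquare′ q _ (h +ᴺ h) d refl (regroup (+ h)) (h+h≤h+1+h h) ℕP.≤-refl) ,
                 trans (cong ∣_∣ (y-offset q (+ 0 , + (h +ᴺ h)) z₀ (+ h) (+ h) refl)) e
    where
    regroup : ∀ h → ((h + h) - + 0) + + 1 ≡ h + (+ 1 + h)
    regroup = ℤ-solve
  ... | inj₂ e = q ⊕ (+ 0 , + 0) , square⊆A (⊕-inSquare′ q _ 0 1 refl refl z≤n (ℕP.≤-trans (s≤s z≤n) (ℕP.m≤n+m (suc h) h))) ,
                 trans (cong ∣_∣ (y-offset q (+ 0 , + 0) z₀ (+ h) (- + h) (sym (ℤP.+-inverseʳ (+ h))))) e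
  zeros : ρ ≡ 0 × ∣ Dy ∣ ≡ 0
  zeros with far-x far | far-y
  ... | z₁ , z₁∈ , e₁ | z₂ , z₂∈ , e₂ =
    m+h+n+k≤h+k⇒m≡0×n≡0 ρ ∣ Dy ∣ (suc h) h
      (subst₂ _≤ᴺ_ (cong₂ _+ᴺ_ e₁ e₂) (ℕP.+-comm h (suc h)) (anticode-cross≤ an z₁∈ z₂∈))
  Yq+h≡ : Y q + + h ≡ Y z₀
  Yq+h≡ = ℤP.i-j≡0⇒i≡j (Y q + + h) (Y z₀) (ℤP.∣i∣≡0⇒i≡0 (proj₂ zeros))
  expand : ∀ x w → + 2 ℤ.* (x + w) + + 1 ≡ + 2 ℤ.* x + (w + w + + 1)
  expand = ℤ-solve
  x-eq : + 2 ℤ.* X q + + 1 ≡ + 2 ℤ.* X z₀ + (W + W + + 1)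
  x-eq = trans (cong (λ t → + 2 ℤ.* t + + 1) (Equivalence.to (i-j≡k⇔i≡j+k (X q) (X z₀) W) refl)) (expand (X z₀) W)
  regroup : ∀ y h → + 2 ℤ.* y + (h + (+ 1 + h)) - + 1 ≡ + 2 ℤ.* (y + h) + + 0
  regroup = ℤ-solve
  y-eq : + 2 ℤ.* Y q + + d - + 1 ≡ + 2 ℤ.* Y z₀ + + 0
  y-eq = trans (regroup (Y q) (+ h)) (cong (λ t → + 2 ℤ.* t + + 0) Yq+h≡)
  shift∈ : (W ≡ + 0) ⊎ (W ≡ -[1+ 0 ]) → (W + W + + 1 , + 0) ∈ doubledShifts
  shift∈ (inj₁ e) = subst (λ w → (w + w + + 1 , + 0) ∈ doubledShifts) (sym e) (here refl)
  shift∈ (inj₂ e) = subst (λ w → (w + w + + 1 , + 0) ∈ doubledShifts) (sym e) (there (there (here refl)))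

optimal-even⇒ball : ∀ {d} h z₀ A → d ≡ h +ᴺ h → IsOptimalAnticode d z₀ A →
                    ∀ z → (z ∈ A) ⇔ InScaledBall (dbl z₀) d z
optimal-even⇒ball h z₀ A refl opt = ball (optimal-even⇒square h z₀ A opt)
  where
  ball : (Σ Point λ q → ∀ z → (z ∈ A) ⇔ InRotatedSquare (σ q) (δ q) (h +ᴺ h) z) →
         ∀ z → (z ∈ A) ⇔ InScaledBall (dbl z₀) (h +ᴺ h) z
  ball (q , A⇔) z = ⇔.trans (A⇔ z) (subst (λ C → InRotatedSquare (σ q) (δ q) (h +ᴺ h) z ⇔ InScaledBall C (h +ᴺ h) z)
    (centre-even h z₀ q (proj₁ opt) (λ {w} → Equivalence.from (A⇔ w))) (inRotatedSquare⇔inScaledBall[centre] q (h +ᴺ h) z))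

optimal-odd⇒ball : ∀ {d} h z₀ A → d ≡ h +ᴺ suc h → IsOptimalAnticode d z₀ A →
                   ∃[ ξ ] (ξ ∈ doubledShifts × (∀ z → (z ∈ A) ⇔ InScaledBall (dbl z₀ ⊕ ξ) d z))
optimal-odd⇒ball h z₀ A refl opt = ball (optimal-odd⇒square h z₀ A opt)
  where
  d = h +ᴺ suc h
  ball : Σ Point (IsLatticeSquare d A) → ∃[ ξ ] (ξ ∈ doubledShifts × (∀ z → (z ∈ A) ⇔ InScaledBall (dbl z₀ ⊕ ξ) d z))
  ball (q , inj₁ A⇔) with centre-odd h z₀ q (proj₁ opt) (λ {w} → Equivalence.from (A⇔ w))
  ... | ξ , ξ∈ , centre≡ = ξ , ξ∈ , λ z → ⇔.trans (A⇔ z)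
          (subst (λ C → InRotatedSquare (σ q) (δ q) d z ⇔ InScaledBall C d z) centre≡
            (inRotatedSquare⇔inScaledBall[centre] q d z))
  ball (q , inj₂ A⇔) with centre′-odd h z₀ q (proj₁ opt) (λ {w} → Equivalence.from (A⇔ w))
  ... | ξ , ξ∈ , centre≡ = ξ , ξ∈ , λ z → ⇔.trans (A⇔ z)
          (subst (λ C → InRotatedSquare (σ q) (δ q - + 1) d z ⇔ InScaledBall C d z) centre≡
            (inRotatedSquare⇔inScaledBall[centre′] q d z))

theorem7 : (d : ℕ) (z₀ : Point) (A : List Point) → IsOptimalAnticode d z₀ A →
    (∀ k → d ≡ 2 * k → ∀ z → (z ∈ A) ⇔ InScaledBall (dbl z₀) d z) ×
    (∀ k → d ≡ suc (2 * k) →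
      ∃[ ξ ] (ξ ∈ doubledShifts × (∀ z → (z ∈ A) ⇔ InScaledBall (dbl z₀ ⊕ ξ) d z)))
theorem7 d z₀ A opt =
  (λ k d≡2k → optimal-even⇒ball k z₀ A (trans d≡2k (2*n≡n+n k)) opt) ,
  (λ k d≡1+2k → optimal-odd⇒ball k z₀ A (trans d≡1+2k (1+2*n≡n+1+n k)) opt)
  where
  1+2*n≡n+1+n : ∀ n → suc (2 * n) ≡ n +ᴺ suc n
  1+2*n≡n+1+n = ℕ-solve
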